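{- Let $k\geq 3$ be an integer, let $n\geq 2$ be a practical number with $k\mid\sigma(n)$, and let $x$ be a $(k-1)$-layered number with $\gcd(n,x)=1$. Then $nx$ is a $k$-layered number.
   Context: $\sigma(n)$ denotes the sum of the positive divisors of $n$. A positive integer $n$ is practical if every positive integer less than $n$ can be written as a sum of distinct positive divisors of $n$. For a positive integer $k$, $n$ is $k$-layered if its set of positive divisors can be partitioned into $k$ disjoint subsets with equal sums. -}

module Defs where

open import Data.Nat using (ℕ; zero; suc; _+_; _*_; _≤_; _<_)
open import Data.Nat.Divisibility using (_∣_; _∣?_)
open import Data.Nat.ListAction using (sum)
open import Data.List using (List; filter; upTo; map)
open import Data.List.Relation.Binary.Sublist.Propositional using (_⊆_)
open import Data.Fin using (Fin)
open import Data.Fin.Properties using () renaming (_≟_ to _≟ᶠ_)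
open import Data.Product using (∃; _×_)
open import Relation.Binary.PropositionalEquality using (_≡_)

range1 : ℕ → List ℕ
range1 n = map suc (upTo n)

divisors : ℕ → List ℕ
divisors n = filter (_∣? n) (range1 n)

σ : ℕ → ℕ
σ n = sum (divisors n)

-- n is practical: every positive integer m < n is a sum of distinct divisors of n
-- (a sub-list of the duplicate-free list of divisors = a set of distinct divisors)
Practical : ℕ → Set
Practical n = ∀ m → 1 ≤ m → m < n → ∃ λ (S : List ℕ) → S ⊆ divisors n × sum S ≡ m

part : ∀ {k} → ℕ → (ℕ → Fin k) → Fin k → List ℕ
part n f i = filter (λ d → f d ≟ᶠ i) (divisors n)

-- A partition into k (labelled) parts is given by an
-- assignment f of a part index to each divisor.
Layered : ℕ → ℕ → Set
Layered k n = ∃ λ (f : ℕ → Fin k) → ∀ i j → sum (part n f i) ≡ sum (part n f j)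

module Submission where

open import Defs
open import Data.Nat using (ℕ; _*_; _≤_; _∸_)
open import Data.Nat.Divisibility using (_∣_)
open import Data.Nat.GCD using (gcd)
open import Relation.Binary.PropositionalEquality using (_≡_)

-- Write σ(n) = q·k.  Because n is practical, every m ≤ σ(n), and
-- not only every m < n, is a sum of distinct divisors of n: by Srinivasan's
-- observation each divisor of n is at most one more than the sum of the
-- smaller divisors, and Brown's completeness criterion turns this into
-- representability of all m ≤ σ(n).  So some set B of divisors of n has sum q,
-- and its complement has sum q(k-1).  Let g be a (k-1)-layering of x with
-- common part sum A, so that σ(x) = (k-1)·A.  Since gcd(n,x) = 1, every divisor
-- c of n·x is uniquely d·e with d = gcd(c,n) ∣ n and e = gcd(c,x) ∣ x.  Put c
-- into part 0 if d ∈ B, and into part j+1 if d ∉ B and e lies in part j of g.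
-- Then part 0 has sum q·σ(x) and part j+1 has sum q(k-1)·A, both q(k-1)·A.

open import Data.Nat using (zero; suc; _+_; _<_; _≤?_; _≟_; s≤s; z≤n; NonZero; ≢-nonZero⁻¹; >-nonZero)
open import Data.Nat.Properties
open import Data.Nat.Divisibility
  using (divides; _∣?_; ∣-trans; ∣-antisym; m∣m*n; n∣m*n; *-monoˡ-∣; *-pres-∣; ∣⇒≤; 0∣⇒≡0)
open import Data.Nat.GCD
  using (gcd[m,n]∣m; gcd[m,n]∣n; gcd-greatest; gcd-comm; gcd-identityʳ; c*gcd[m,n]≡gcd[cm,cn])
open import Data.Nat.Coprimality using (Coprime; coprime-divisor; gcd≡1⇒coprime)
  renaming (sym to coprime-sym)
open import Data.Nat.ListAction using (sum)
open import Data.Nat.ListAction.Properties using (sum-++; sum-↭)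
open import Data.List using (List; []; _∷_; _++_; map; filter; upTo)
open import Data.List.Properties using (map-++; map-∘; map-id; map-cong-local; upTo-∷ʳ)
open import Data.List.Membership.Propositional using (_∈_)
open import Data.List.Membership.Propositional.Properties
  using (∈-filter⁺; ∈-filter⁻; ∈-map⁺; ∈-map⁻; ∈-upTo⁺; ∈-++⁺ˡ; ∈-++⁺ʳ; ∈-++⁻)
open import Data.List.Membership.Propositional.Properties.WithK using (unique∧set⇒bag)
open import Data.List.Relation.Binary.BagAndSetEquality using (∼bag⇒↭)
import Data.List.Relation.Binary.Permutation.Propositional.Properties as Perm
open import Data.List.Relation.Binary.Sublist.Propositional using (_⊆_; []; _∷_; _∷ʳ_)
open import Data.List.Relation.Unary.Any using (here; there)
open import Data.List.Relation.Unary.All as All using (All; _∷_)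
open import Data.List.Relation.Unary.AllPairs using ([]; _∷_)
open import Data.List.Relation.Unary.Unique.Propositional using (Unique)
import Data.List.Relation.Unary.Unique.Propositional.Properties as Unique
open import Data.Fin as Fin using (Fin)
open import Data.Fin.Properties using () renaming (_≟_ to _≟ᶠ_)
open import Algebra.Properties.CommutativeMonoid.Sum +-0-commutativeMonoid
  using (sum-syntax; sum-cong-≗; ∑-distrib-+)
open import Algebra.Properties.CommutativeSemigroup +-commutativeSemigroup using (interchange)
open import Data.Bool using (Bool; true; false; if_then_else_; not)
open import Data.Product using (∃; _×_; _,_; proj₁; proj₂)
open import Data.Sum using (inj₁; inj₂)
open import Data.Empty using (⊥)
open import Function using (_∘_; id; mk⇔)
open import Relation.Nullary using (does; yes; no; contradiction)
open import Relation.Nullary.Decidable using (dec-true; dec-false)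
open import Relation.Unary using (Pred; Decidable)
open import Relation.Binary.PropositionalEquality using (refl; sym; trans; cong; cong₂; subst; module ≡-Reasoning)

open ≡-Reasoning

-- A subset of ℕ is given by its characteristic function B; select B weighs
-- the selected numbers by themselves and the others by 0.
select : (ℕ → Bool) → ℕ → ℕ
select B c = if B c then c else 0

Σ-cong : ∀ {f g : ℕ → ℕ} L → (∀ {c} → c ∈ L → f c ≡ g c) → sum (map f L) ≡ sum (map g L)
Σ-cong L f≡g = cong sum (map-cong-local (All.tabulate f≡g))

Σ-+ : ∀ (f g : ℕ → ℕ) L → sum (map (λ c → f c + g c) L) ≡ sum (map f L) + sum (map g L)
Σ-+ f g [] = refl
Σ-+ f g (c ∷ L) = trans (cong (f c + g c +_) (Σ-+ f g L)) (interchange (f c) (g c) _ _)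

Σ-*ˡ : ∀ a (f : ℕ → ℕ) L → sum (map (λ c → a * f c) L) ≡ a * sum (map f L)
Σ-*ˡ a f [] = sym (*-zeroʳ a)
Σ-*ˡ a f (c ∷ L) = trans (cong (a * f c +_) (Σ-*ˡ a f L)) (sym (*-distribˡ-+ a (f c) _))

Σ-factorise : ∀ (a b : ℕ → ℕ) D E →
  sum (map (λ d → sum (map (λ e → a d * b e) E)) D) ≡ sum (map a D) * sum (map b E)
Σ-factorise a b [] E = refl
Σ-factorise a b (d ∷ D) E =
  trans (cong₂ _+_ (Σ-*ˡ (a d) b E) (Σ-factorise a b D E))
        (sym (*-distribʳ-+ (sum (map b E)) (a d) _))

Σ-filter : ∀ {p} {P : Pred ℕ p} (P? : Decidable P) (f : ℕ → ℕ) L →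
  sum (map f (filter P? L)) ≡ sum (map (λ c → if does (P? c) then f c else 0) L)
Σ-filter P? f [] = refl
Σ-filter P? f (c ∷ L) with does (P? c)
... | true  = cong (f c +_) (Σ-filter P? f L)
... | false = Σ-filter P? f L

sum-filter : ∀ {p} {P : Pred ℕ p} (P? : Decidable P) L →
  sum (filter P? L) ≡ sum (map (λ c → if does (P? c) then c else 0) L)
sum-filter P? L = trans (cong sum (sym (map-id (filter P? L)))) (Σ-filter P? id L)

Σ-complement : ∀ B L {s t} → sum (map (select B) L) ≡ s → sum L ≡ s + t →
  sum (map (select (not ∘ B)) L) ≡ t
Σ-complement B L {s} {t} sumB≡s sumL≡s+t = +-cancelˡ-≡ s _ t (begin
  s + sum (map (select (not ∘ B)) L)
    ≡⟨ cong (_+ sum (map (select (not ∘ B)) L)) sumB≡s ⟨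
  sum (map (select B) L) + sum (map (select (not ∘ B)) L)
    ≡⟨ Σ-+ (select B) (select (not ∘ B)) L ⟨
  sum (map (λ c → select B c + select (not ∘ B) c) L)
    ≡⟨ Σ-cong L (λ {c} _ → split c) ⟩
  sum (map id L)
    ≡⟨ cong sum (map-id L) ⟩
  sum L
    ≡⟨ sumL≡s+t ⟩
  s + t ∎)
  where
  split : ∀ c → select B c + select (not ∘ B) c ≡ c
  split c with B c
  ... | true  = +-identityʳ c
  ... | false = refl

Σ-sameMembers : ∀ (h : ℕ → ℕ) {xs ys} → Unique xs → Unique ys →
  (∀ {z} → z ∈ xs → z ∈ ys) → (∀ {z} → z ∈ ys → z ∈ xs) → sum (map h xs) ≡ sum (map h ys)
Σ-sameMembers h ux uy to from = sum-↭ (Perm.map⁺ h (∼bag⇒↭ (unique∧set⇒bag ux uy (mk⇔ to from))))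

∈⇒≤sum : ∀ {c} S → c ∈ S → c ≤ sum S
∈⇒≤sum (c ∷ S) (here refl) = m≤m+n c (sum S)
∈⇒≤sum (d ∷ S) (there c∈S) = ≤-trans (∈⇒≤sum S c∈S) (m≤n+m (sum S) d)

sublist-sum≤ : ∀ j {S L : List ℕ} → S ⊆ L → All (_≤ j) S →
  sum S ≤ sum (map (λ c → if does (c ≤? j) then c else 0) L)
sublist-sum≤ j [] _ = z≤n
sublist-sum≤ j (y ∷ʳ S⊆L) S≤j = ≤-trans (sublist-sum≤ j S⊆L S≤j) (m≤n+m _ _)
sublist-sum≤ j (_∷_ {x = y} refl S⊆L) (y≤j ∷ S≤j)
  rewrite dec-true (y ≤? j) y≤j = +-monoʳ-≤ y (sublist-sum≤ j S⊆L S≤j)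

∑-const : ∀ m A → ∑[ j < m ] A ≡ m * A
∑-const zero    A = refl
∑-const (suc m) A = cong (A +_) (∑-const m A)

∑-indicator : ∀ {m} (t : Fin m) c → ∑[ j < m ] (if does (t ≟ᶠ j) then c else 0) ≡ c
∑-indicator {suc m} Fin.zero c = begin
  c + ∑[ j < m ] 0 ≡⟨ cong (c +_) (trans (∑-const m 0) (*-zeroʳ m)) ⟩
  c + 0            ≡⟨ +-identityʳ c ⟩
  c                ∎
∑-indicator {suc m} (Fin.suc t) c = ∑-indicator t c

∑-parts : ∀ {m} (f : ℕ → Fin m) L →
  ∑[ j < m ] sum (map (λ c → if does (f c ≟ᶠ j) then c else 0) L) ≡ sum L
∑-parts {m} f [] = trans (∑-const m 0) (*-zeroʳ m)
∑-parts {m} f (c ∷ L) =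
  trans (∑-distrib-+ (λ j → if does (f c ≟ᶠ j) then c else 0)
                       (λ j → sum (map (λ c → if does (f c ≟ᶠ j) then c else 0) L)))
        (cong₂ _+_ (∑-indicator (f c) c) (∑-parts f L))

σ-layered : ∀ {m} x (g : ℕ → Fin m) → (∀ i j → sum (part x g i) ≡ sum (part x g j)) →
  ∀ i → σ x ≡ m * sum (part x g i)
σ-layered {m} x g equalParts i = begin
  σ x
    ≡⟨ ∑-parts g (divisors x) ⟨
  ∑[ j < m ] sum (map (λ c → if does (g c ≟ᶠ j) then c else 0) (divisors x))
    ≡⟨ sum-cong-≗ (λ j → trans (sym (sum-filter (λ c → g c ≟ᶠ j) (divisors x))) (equalParts j i)) ⟩
  ∑[ j < m ] sum (part x g i)
    ≡⟨ ∑-const m _ ⟩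
  m * sum (part x g i) ∎

sumTo : ℕ → (ℕ → ℕ) → ℕ
sumTo zero    f = 0
sumTo (suc j) f = sumTo j f + f (suc j)

sumTo-range : ∀ (f : ℕ → ℕ) N → sum (map f (range1 N)) ≡ sumTo N f
sumTo-range f zero    = refl
sumTo-range f (suc N) = begin
  sum (map f (map suc (upTo (suc N))))
    ≡⟨ cong (λ l → sum (map f (map suc l))) (upTo-∷ʳ N) ⟨
  sum (map f (map suc (upTo N ++ N ∷ [])))
    ≡⟨ cong (sum ∘ map f) (map-++ suc (upTo N) (N ∷ [])) ⟩
  sum (map f (range1 N ++ suc N ∷ []))
    ≡⟨ cong sum (map-++ f (range1 N) (suc N ∷ [])) ⟩
  sum (map f (range1 N) ++ f (suc N) ∷ [])
    ≡⟨ sum-++ (map f (range1 N)) _ ⟩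
  sum (map f (range1 N)) + (f (suc N) + 0)
    ≡⟨ cong₂ _+_ (sumTo-range f N) (+-identityʳ _) ⟩
  sumTo N f + f (suc N) ∎

sumTo-cong : ∀ j {f g : ℕ → ℕ} → (∀ c → c ≤ j → f c ≡ g c) → sumTo j f ≡ sumTo j g
sumTo-cong zero    f≡g = refl
sumTo-cong (suc j) f≡g =
  cong₂ _+_ (sumTo-cong j (λ c c≤j → f≡g c (m≤n⇒m≤1+n c≤j))) (f≡g (suc j) ≤-refl)

sumTo-truncate : ∀ {j} N (f : ℕ → ℕ) → j ≤ N → (∀ c → j < c → f c ≡ 0) → sumTo N f ≡ sumTo j f
sumTo-truncate zero    f z≤n _ = refl
sumTo-truncate (suc N) f j≤N vanish with m≤n⇒m<n∨m≡n j≤N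
... | inj₂ refl = refl
... | inj₁ j<N  = trans (cong₂ _+_ (sumTo-truncate N f (≤-pred j<N) vanish) (vanish (suc N) j<N))
                        (+-identityʳ _)

-- Brown's completeness criterion for a set P of positive integers

module Completeness {p} {P : Pred ℕ p} (P? : Decidable P) where

  weight : (ℕ → Bool) → ℕ → ℕ
  weight B c = if does (P? c) then select B c else 0

  ΣP : ℕ → ℕ
  ΣP j = sumTo j (weight (λ _ → true))

  _[_≔_] : (ℕ → Bool) → ℕ → Bool → ℕ → Bool
  (B [ a ≔ b ]) c = if does (c ≟ a) then b else B c

  select-update : ∀ B a b → select (B [ a ≔ b ]) a ≡ select (λ _ → b) a
  select-update B a b = cong (λ t → if (if t then b else B a) then a else 0) (dec-true (a ≟ a) refl)

  sumTo-update : ∀ B j b → sumTo j (weight (B [ suc j ≔ b ])) ≡ sumTo j (weight B)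
  sumTo-update B j b = sumTo-cong j λ c c≤j →
    cong (λ t → if does (P? c) then (if (if t then b else B c) then c else 0) else 0)
         (dec-false (c ≟ suc j) (<⇒≢ (s≤s c≤j)))

  Complete : ℕ → Set p
  Complete N = ∀ j → j < N → P (suc j) → j ≤ ΣP j

  complete-pred : ∀ {N} → Complete (suc N) → Complete N
  complete-pred complete j j<N = complete j (m<n⇒m<1+n j<N)

  brown : ∀ N → Complete N → ∀ m → m ≤ ΣP N → ∃ λ B → sumTo N (weight B) ≡ m
  brown zero    _        m m≤0 = (λ _ → false) , sym (n≤0⇒n≡0 m≤0)
  brown (suc j) complete m m≤ with P? (suc j)
  ... | no _ =
    let B , sumB = brown j (complete-pred complete) m (≤-trans m≤ (≤-reflexive (+-identityʳ _))) in
    B , trans (+-identityʳ _) sumB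
  ... | yes j+1∈P with m ≤? ΣP j
  ...   | yes m≤ΣPj =
    let B , sumB = brown j (complete-pred complete) m m≤ΣPj in
    B [ suc j ≔ false ] ,
    trans (cong₂ _+_ (sumTo-update B j false) (select-update B (suc j) false))
          (trans (+-identityʳ _) sumB)
  -- m > ΣP j ≥ j: represent m - (j+1) within [1, j] and add j+1
  ...   | no m≰ΣPj =
    let B , sumB = brown j (complete-pred complete) (m ∸ suc j) rest≤ in
    B [ suc j ≔ true ] ,
    trans (cong₂ _+_ (sumTo-update B j true) (select-update B (suc j) true))
          (trans (cong (_+ suc j) sumB) (m∸n+n≡m j+1≤m))
    where
    j+1≤m : suc j ≤ m
    j+1≤m = ≤-trans (s≤s (complete j ≤-refl j+1∈P)) (≰⇒> m≰ΣPj)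
    rest≤ : m ∸ suc j ≤ ΣP j
    rest≤ = m≤n+o⇒m∸n≤o m (suc j)
              (≤-trans m≤ (≤-reflexive (+-comm (ΣP j) (suc j))))

-- Practical numbers: every m ≤ σ(n) is a sum of distinct divisors of n

open Completeness using (weight; ΣP; Complete; brown)

Σ-divisors : ∀ n (f : ℕ → ℕ) →
  sum (map f (divisors n)) ≡ sumTo n (λ c → if does (c ∣? n) then f c else 0)
Σ-divisors n f = trans (Σ-filter (_∣? n) f (range1 n)) (sumTo-range _ n)

σ≡ΣP : ∀ n → σ n ≡ ΣP (_∣? n) n
σ≡ΣP n = trans (cong sum (sym (map-id (divisors n)))) (Σ-divisors n id)

Σ-divisors≤ : ∀ n j → j ≤ n →
  sum (map (λ c → if does (c ≤? j) then c else 0) (divisors n)) ≡ ΣP (_∣? n) j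
Σ-divisors≤ n j j≤n = begin
  sum (map below-j (divisors n))
    ≡⟨ Σ-divisors n below-j ⟩
  sumTo n (λ c → if does (c ∣? n) then below-j c else 0)
    ≡⟨ sumTo-truncate n _ j≤n beyond ⟩
  sumTo j (λ c → if does (c ∣? n) then below-j c else 0)
    ≡⟨ sumTo-cong j within ⟩
  ΣP (_∣? n) j ∎
  where
  below-j : ℕ → ℕ
  below-j c = if does (c ≤? j) then c else 0
  beyond : ∀ c → j < c → (if does (c ∣? n) then below-j c else 0) ≡ 0
  beyond c j<c with does (c ∣? n)
  ... | true  = cong (λ t → if t then c else 0) (dec-false (c ≤? j) (<⇒≱ j<c))
  ... | false = refl
  within : ∀ c → c ≤ j → (if does (c ∣? n) then below-j c else 0) ≡ weight (_∣? n) (λ _ → true) c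
  within c c≤j with does (c ∣? n)
  ... | true  = cong (λ t → if t then c else 0) (dec-true (c ≤? j) c≤j)
  ... | false = refl

-- Srinivasan: each divisor j+1 of a practical number n exceeds the sum of
-- the smaller divisors by at most 1; otherwise ΣP j + 1 < j + 1 ≤ n would be
-- a sum of distinct divisors, all ≤ j, hence a sum of at most ΣP j.
practical⇒complete : ∀ n → Practical n → Complete (_∣? n) n
practical⇒complete n practical j j<n _ with j ≤? ΣP (_∣? n) j
... | yes j≤ΣP = j≤ΣP
... | no  j≰ΣP = contradiction (≤-trans (≤-reflexive (sym sumS)) S≤T) (<⇒≱ ≤-refl)
  where
  T : ℕ
  T = ΣP (_∣? n) j
  T<j : T < j
  T<j = ≰⇒> j≰ΣP
  representation : ∃ λ S → S ⊆ divisors n × sum S ≡ suc T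
  representation = practical (suc T) (s≤s z≤n) (≤-trans (s≤s T<j) j<n)
  S : List ℕ
  S = proj₁ representation
  sumS : sum S ≡ suc T
  sumS = proj₂ (proj₂ representation)
  S≤T : sum S ≤ T
  S≤T = ≤-trans (sublist-sum≤ j (proj₁ (proj₂ representation))
                   (All.tabulate λ c∈S → ≤-trans (∈⇒≤sum S c∈S) (≤-trans (≤-reflexive sumS) T<j)))
                (≤-reflexive (Σ-divisors≤ n j (<⇒≤ j<n)))

practical-subsetSum : ∀ n → Practical n → ∀ m → m ≤ σ n →
  ∃ λ B → sum (map (select B) (divisors n)) ≡ m
practical-subsetSum n practical m m≤σ =
  let B , sumB = brown (_∣? n) n (practical⇒complete n practical) m (≤-trans m≤σ (≤-reflexive (σ≡ΣP n)))
  in B , trans (Σ-divisors n (select B)) sumB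

-- Divisors of a product of coprime numbers

gcd-*-coprime : ∀ {a b p q} → a ∣ p → b ∣ q → Coprime p q → gcd (a * b) p ≡ a
gcd-*-coprime {a} {b} {p} a∣p b∣q coprime = ∣-antisym g∣a a∣g
  where
  g : ℕ
  g = gcd (a * b) p
  a∣g : a ∣ g
  a∣g = gcd-greatest (m∣m*n b) a∣p
  g⊥b : Coprime g b
  g⊥b (i∣g , i∣b) = coprime (∣-trans i∣g (gcd[m,n]∣n (a * b) p) , ∣-trans i∣b b∣q)
  g∣a : g ∣ a
  g∣a = coprime-divisor g⊥b (subst (g ∣_) (*-comm a b) (gcd[m,n]∣m (a * b) p))

coprime-*-∣ : ∀ {a b c} → Coprime a b → a ∣ c → b ∣ c → a * b ∣ c
coprime-*-∣ {a} {b} a⊥b (divides q refl) b∣qa =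
  subst (_∣ q * a) (*-comm b a) (*-monoˡ-∣ a b∣q)
  where
  b∣q : b ∣ q
  b∣q = coprime-divisor (coprime-sym a⊥b) (subst (b ∣_) (*-comm q a) b∣qa)

∣-*-split : ∀ {c n x} → Coprime n x → c ∣ n * x → c ≡ gcd c n * gcd c x
∣-*-split {c} {n} {x} n⊥x c∣nx = ∣-antisym c∣de de∣c
  where
  d e : ℕ
  d = gcd c n
  e = gcd c x
  c∣xd : c ∣ x * d
  c∣xd = subst (c ∣_) (sym (c*gcd[m,n]≡gcd[cm,cn] x c n))
           (gcd-greatest (n∣m*n x) (subst (c ∣_) (*-comm n x) c∣nx))
  c∣de : c ∣ d * e
  c∣de = subst (c ∣_) (trans (sym (c*gcd[m,n]≡gcd[cm,cn] d x c)) (cong (d *_) (gcd-comm x c)))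
           (gcd-greatest (subst (c ∣_) (*-comm x d) c∣xd) (n∣m*n d))
  d⊥e : Coprime d e
  d⊥e (i∣d , i∣e) = n⊥x (∣-trans i∣d (gcd[m,n]∣n c n) , ∣-trans i∣e (gcd[m,n]∣n c x))
  de∣c : d * e ∣ c
  de∣c = coprime-*-∣ d⊥e (gcd[m,n]∣m c n) (gcd[m,n]∣m c x)

divisors-unique : ∀ N → Unique (divisors N)
divisors-unique N = Unique.filter⁺ (_∣? N) (Unique.map⁺ suc-injective (Unique.upTo⁺ N))

∈-divisors⁻ : ∀ {c N} → c ∈ divisors N → c ∣ N × 0 < c
∈-divisors⁻ {c} {N} c∈ with ∈-filter⁻ (_∣? N) {xs = range1 N} c∈
... | c∈range , c∣N with ∈-map⁻ suc c∈range
...   | _ , _ , refl = c∣N , s≤s z≤n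

∈-divisors⁺ : ∀ {c N} .{{_ : NonZero N}} → c ∣ N → c ∈ divisors N
∈-divisors⁺ {zero}  {N} 0∣N = contradiction (0∣⇒≡0 0∣N) (≢-nonZero⁻¹ N)
∈-divisors⁺ {suc c} {N} c∣N = ∈-filter⁺ (_∣? N) (∈-map⁺ suc (∈-upTo⁺ (∣⇒≤ c∣N))) c∣N

products : List ℕ → List ℕ → List ℕ
products []      E = []
products (d ∷ D) E = map (d *_) E ++ products D E

Σ-products : ∀ (h : ℕ → ℕ) D E →
  sum (map h (products D E)) ≡ sum (map (λ d → sum (map (λ e → h (d * e)) E)) D)
Σ-products h []      E = refl
Σ-products h (d ∷ D) E = begin
  sum (map h (map (d *_) E ++ products D E))
    ≡⟨ cong sum (map-++ h (map (d *_) E) (products D E)) ⟩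
  sum (map h (map (d *_) E) ++ map h (products D E))
    ≡⟨ sum-++ (map h (map (d *_) E)) _ ⟩
  sum (map h (map (d *_) E)) + sum (map h (products D E))
    ≡⟨ cong₂ _+_ (cong sum (sym (map-∘ E))) (Σ-products h D E) ⟩
  sum (map (λ e → h (d * e)) E) + sum (map (λ d → sum (map (λ e → h (d * e)) E)) D) ∎

∈-products⁻ : ∀ {c} D E → c ∈ products D E → ∃ λ d → ∃ λ e → d ∈ D × e ∈ E × c ≡ d * e
∈-products⁻ (d ∷ D) E c∈ with ∈-++⁻ (map (d *_) E) c∈
... | inj₁ c∈dE with ∈-map⁻ (d *_) c∈dE
...   | e , e∈E , refl = d , e , here refl , e∈E , refl
∈-products⁻ (d ∷ D) E c∈ | inj₂ c∈DE with ∈-products⁻ D E c∈DE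
...   | d′ , e , d′∈D , e∈E , c≡ = d′ , e , there d′∈D , e∈E , c≡

∈-products⁺ : ∀ {d e} D E → d ∈ D → e ∈ E → d * e ∈ products D E
∈-products⁺ (d ∷ D) E (here refl) e∈E = ∈-++⁺ˡ (∈-map⁺ (d *_) e∈E)
∈-products⁺ (d ∷ D) E (there d∈D) e∈E = ∈-++⁺ʳ (map (d *_) E) (∈-products⁺ D E d∈D e∈E)

products-unique : ∀ (key : ℕ → ℕ) D E → Unique D → Unique E → All (0 <_) D →
  (∀ {d e} → d ∈ D → e ∈ E → key (d * e) ≡ d) → Unique (products D E)
products-unique key []      E _              _       _             _     = []
products-unique key (d ∷ D) E (d≢D ∷ uniqD) uniqE (0<d ∷ 0<D) keyOk =
  Unique.++⁺ (Unique.map⁺ d*-injective uniqE)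
             (products-unique key D E uniqD uniqE 0<D (keyOk ∘ there))
             disjoint
  where
  d*-injective : ∀ {a b} → d * a ≡ d * b → a ≡ b
  d*-injective {a} {b} = *-cancelˡ-≡ a b d {{>-nonZero 0<d}}
  disjoint : ∀ {c} → c ∈ map (d *_) E × c ∈ products D E → ⊥
  disjoint (c∈dE , c∈DE) with ∈-map⁻ (d *_) c∈dE | ∈-products⁻ D E c∈DE
  ... | e , e∈E , refl | d′ , e′ , d′∈D , e′∈E , de≡d′e′ =
    All.lookup d≢D d′∈D (trans (sym (keyOk (here refl) e∈E))
                              (trans (cong key de≡d′e′) (keyOk (there d′∈D) e′∈E)))

Σ-divisors-* : ∀ {n x} .{{_ : NonZero n}} .{{_ : NonZero x}} → Coprime n x → ∀ (h : ℕ → ℕ) →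
  sum (map h (divisors (n * x))) ≡ sum (map (λ d → sum (map (λ e → h (d * e)) (divisors x))) (divisors n))
Σ-divisors-* {n} {x} n⊥x h =
  trans (Σ-sameMembers h (divisors-unique (n * x)) products-uniq to from)
        (Σ-products h (divisors n) (divisors x))
  where
  instance
    nx≢0 : NonZero (n * x)
    nx≢0 = m*n≢0 n x
  products-uniq : Unique (products (divisors n) (divisors x))
  products-uniq = products-unique (λ c → gcd c n) (divisors n) (divisors x)
    (divisors-unique n) (divisors-unique x) (All.tabulate λ d∈ → proj₂ (∈-divisors⁻ {N = n} d∈))
    (λ d∈ e∈ → gcd-*-coprime (proj₁ (∈-divisors⁻ {N = n} d∈)) (proj₁ (∈-divisors⁻ {N = x} e∈)) n⊥x)
  to : ∀ {c} → c ∈ divisors (n * x) → c ∈ products (divisors n) (divisors x)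
  to {c} c∈ = subst (_∈ products (divisors n) (divisors x)) (sym (∣-*-split n⊥x c∣nx))
    (∈-products⁺ (divisors n) (divisors x) (∈-divisors⁺ (gcd[m,n]∣n c n)) (∈-divisors⁺ (gcd[m,n]∣n c x)))
    where
    c∣nx : c ∣ n * x
    c∣nx = proj₁ (∈-divisors⁻ c∈)
  from : ∀ {c} → c ∈ products (divisors n) (divisors x) → c ∈ divisors (n * x)
  from c∈ with ∈-products⁻ (divisors n) (divisors x) c∈
  ... | d , e , d∈ , e∈ , refl =
    ∈-divisors⁺ (*-pres-∣ (proj₁ (∈-divisors⁻ {N = n} d∈)) (proj₁ (∈-divisors⁻ {N = x} e∈)))

-- The product layering of n·x

module ProductLayering {n x} .{{_ : NonZero n}} .{{_ : NonZero x}} (n⊥x : Coprime n x)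
                       {m} (B : ℕ → Bool) (g : ℕ → Fin m) where

  label : ℕ → ℕ → Fin (suc m)
  label d e = if B d then Fin.zero else Fin.suc (g e)

  layering : ℕ → Fin (suc m)
  layering c = label (gcd c n) (gcd c x)

  layering-* : ∀ {d e} → d ∈ divisors n → e ∈ divisors x → layering (d * e) ≡ label d e
  layering-* {d} {e} d∈ e∈ = cong₂ label
    (gcd-*-coprime d∣n e∣x n⊥x)
    (trans (cong (λ c → gcd c x) (*-comm d e)) (gcd-*-coprime e∣x d∣n (coprime-sym n⊥x)))
    where
    d∣n : d ∣ n
    d∣n = proj₁ (∈-divisors⁻ {N = n} d∈)
    e∣x : e ∣ x
    e∣x = proj₁ (∈-divisors⁻ {N = x} e∈)

  part-factorises : ∀ i (a b : ℕ → ℕ) →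
    (∀ d e → (if does (label d e ≟ᶠ i) then d * e else 0) ≡ a d * b e) →
    sum (part (n * x) layering i) ≡ sum (map a (divisors n)) * sum (map b (divisors x))
  part-factorises i a b weight≡ = begin
    sum (part (n * x) layering i)
      ≡⟨ sum-filter (λ c → layering c ≟ᶠ i) (divisors (n * x)) ⟩
    sum (map inPart (divisors (n * x)))
      ≡⟨ Σ-divisors-* n⊥x inPart ⟩
    sum (map (λ d → sum (map (λ e → inPart (d * e)) (divisors x))) (divisors n))
      ≡⟨ Σ-cong (divisors n) (λ d∈ → Σ-cong (divisors x) (λ e∈ → inPart-* d∈ e∈)) ⟩
    sum (map (λ d → sum (map (λ e → a d * b e) (divisors x))) (divisors n))
      ≡⟨ Σ-factorise a b (divisors n) (divisors x) ⟩
    sum (map a (divisors n)) * sum (map b (divisors x)) ∎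
    where
    inPart : ℕ → ℕ
    inPart c = if does (layering c ≟ᶠ i) then c else 0
    inPart-* : ∀ {d e} → d ∈ divisors n → e ∈ divisors x → inPart (d * e) ≡ a d * b e
    inPart-* {d} {e} d∈ e∈ =
      trans (cong (λ l → if does (l ≟ᶠ i) then d * e else 0) (layering-* d∈ e∈)) (weight≡ d e)

  part-zero : sum (part (n * x) layering Fin.zero) ≡ sum (map (select B) (divisors n)) * σ x
  part-zero = trans (part-factorises Fin.zero (select B) id weight≡)
                    (cong (sum (map (select B) (divisors n)) *_) (cong sum (map-id (divisors x))))
    where
    weight≡ : ∀ d e → (if does (label d e ≟ᶠ Fin.zero) then d * e else 0) ≡ select B d * e
    weight≡ d e with B d
    ... | true  = refl
    ... | false = refl

  part-suc : ∀ j → sum (part (n * x) layering (Fin.suc j)) ≡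
                   sum (map (select (not ∘ B)) (divisors n)) * sum (part x g j)
  part-suc j = trans (part-factorises (Fin.suc j) (select (not ∘ B)) inPart-j weight≡)
                     (cong (sum (map (select (not ∘ B)) (divisors n)) *_)
                           (sym (sum-filter (λ e → g e ≟ᶠ j) (divisors x))))
    where
    inPart-j : ℕ → ℕ
    inPart-j e = if does (g e ≟ᶠ j) then e else 0
    weight≡ : ∀ d e → (if does (label d e ≟ᶠ Fin.suc j) then d * e else 0) ≡ select (not ∘ B) d * inPart-j e
    weight≡ d e with B d
    ... | true  = refl
    ... | false with does (g e ≟ᶠ j)
    ...   | true  = refl
    ...   | false = sym (*-zeroʳ d)

-- gcd(n, 0) = n, so a number coprime to some n ≥ 2 is nonzero.
coprime⇒nonZero : ∀ {n x} → 2 ≤ n → gcd n x ≡ 1 → NonZero x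
coprime⇒nonZero {n} {zero}  2≤n gcd≡1 =
  contradiction (trans (sym (gcd-identityʳ n)) gcd≡1) (<⇒≢ 2≤n ∘ sym)
coprime⇒nonZero {x = suc _} _   _     = _

mainTheorem12 : (k n x : ℕ) → 3 ≤ k → 2 ≤ n → Practical n → k ∣ σ n →
                Layered (k ∸ 1) x → gcd n x ≡ 1 → Layered k (n * x)
mainTheorem12 (suc k′) n x (s≤s (s≤s _)) 2≤n practical (divides q σn≡q*k) (g , equalParts) gcd≡1 =
  layering , λ i j → trans (part≡ i) (sym (part≡ j))
  where
  instance
    n≢0 : NonZero n
    n≢0 = >-nonZero (≤-trans (s≤s z≤n) 2≤n)
    x≢0 : NonZero x
    x≢0 = coprime⇒nonZero 2≤n gcd≡1
  chosen : ∃ λ B → sum (map (select B) (divisors n)) ≡ q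
  chosen = practical-subsetSum n practical q (≤-trans (m≤m*n q (suc k′)) (≤-reflexive (sym σn≡q*k)))
  B : ℕ → Bool
  B = proj₁ chosen
  complement : sum (map (select (not ∘ B)) (divisors n)) ≡ q * k′
  complement = Σ-complement B (divisors n) (proj₂ chosen) (trans σn≡q*k (*-suc q k′))
  open ProductLayering {n} {x} (gcd≡1⇒coprime gcd≡1) B g
  A : ℕ
  A = sum (part x g Fin.zero)
  part≡ : ∀ i → sum (part (n * x) layering i) ≡ q * k′ * A
  part≡ Fin.zero = begin
    sum (part (n * x) layering Fin.zero) ≡⟨ part-zero ⟩
    sum (map (select B) (divisors n)) * σ x ≡⟨ cong₂ _*_ (proj₂ chosen) (σ-layered x g equalParts Fin.zero) ⟩
    q * (k′ * A) ≡⟨ *-assoc q k′ A ⟨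
    q * k′ * A ∎
  part≡ (Fin.suc j) = trans (part-suc j) (cong₂ _*_ complement (equalParts j Fin.zero))
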